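{- In an abstractly guarded category, the weakening rule holds: if $f\colon X\to_\sigma Y$ and $\theta\colon Y''\triangleleft Y'$, $\sigma\colon Y'\triangleleft Y$ are composable summands, then $f\colon X\to_{\sigma\theta}Y$.
   Context: A co-Cartesian category has finite coproducts. A summand $\sigma\colon Y'\triangleleft Y$ is a pair $(\sigma_1\colon Y'\to Y,\sigma_2\colon Y_2\to Y)$ forming a coproduct cospan (identified with $\sigma_1$); complement $\bar\sigma=(\sigma_2,\sigma_1)$; $\mathrm{inl},\mathrm{inr}$ are the summands of a coproduct $Y+Z$. For $\theta=(\theta_1\colon Y''\to Y',\theta_2\colon Y'_2\to Y')$, the composite summand is $\sigma\theta=(\sigma_1\circ\theta_1,[\sigma_2,\sigma_1\circ\theta_2])\colon Y''\triangleleft Y$. The category is abstractly guarded if equipped with a relation $f\colon X\to_\sigma Y$ between morphisms $f\colon X\to Y$ and summands $\sigma$ of $Y$ closed under: (trv) $\mathrm{inl}\circ f\colon X\to_{\mathrm{inr}}Y+Z$ for all $f\colon X\to Y$; (par) $f\colon X\to_\sigma Z$, $g\colon Y\to_\sigma Z$ imply $[f,g]\colon X+Y\to_\sigma Z$; (cmp) $f\colon X\to_{\mathrm{inr}}Y+Z$, $g\colon Y\to_\sigma V$, $h\colon Z\to V$ imply $[g,h]\circ f\colon X\to_\sigma V$; here $Y+Z$ ranges over all coproducts. -}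

module Defs where

open import Level using (Level; _⊔_; suc)
open import Relation.Binary.PropositionalEquality using (_≡_; refl; sym; trans; cong)
open import Data.Product using (Σ; _×_; _,_)

record Category (o h : Level) : Set (suc (o ⊔ h)) where
  infixr 9 _∘_
  field
    Obj  : Set o
    Hom  : Obj → Obj → Set h
    id   : ∀ {A} → Hom A A
    _∘_  : ∀ {A B C} → Hom B C → Hom A B → Hom A C
    idˡ  : ∀ {A B} (f : Hom A B) → id ∘ f ≡ f
    idʳ  : ∀ {A B} (f : Hom A B) → f ∘ id ≡ f
    assoc : ∀ {A B C D} (f : Hom C D) (g : Hom B C) (k : Hom A B) →
            (f ∘ g) ∘ k ≡ f ∘ (g ∘ k)

module _ {o h : Level} (𝒞 : Category o h) where
  open Category 𝒞

  record IsCoproduct {A B C : Obj} (i₁ : Hom A C) (i₂ : Hom B C) : Set (o ⊔ h) where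
    field
      [_,_]  : ∀ {D} → Hom A D → Hom B D → Hom C D
      inj₁-β : ∀ {D} (f : Hom A D) (g : Hom B D) → [ f , g ] ∘ i₁ ≡ f
      inj₂-β : ∀ {D} (f : Hom A D) (g : Hom B D) → [ f , g ] ∘ i₂ ≡ g
      unique : ∀ {D} (f : Hom A D) (g : Hom B D) (k : Hom C D) →
               k ∘ i₁ ≡ f → k ∘ i₂ ≡ g → k ≡ [ f , g ]

  -- Chosen binary coproducts (co-Cartesian structure; an initial object is
  -- not needed for this statement).
  record CoCartesian : Set (o ⊔ h) where
    infixr 6 _⊕_
    field
      _⊕_ : Obj → Obj → Obj
      ι₁  : ∀ {A B} → Hom A (A ⊕ B)
      ι₂  : ∀ {A B} → Hom B (A ⊕ B)
      isCoproduct : ∀ {A B} → IsCoproduct (ι₁ {A} {B}) (ι₂ {A} {B})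

  record Summand (Y' Y : Obj) : Set (o ⊔ h) where
    constructor summand
    field
      Y₂   : Obj
      σ₁   : Hom Y' Y
      σ₂   : Hom Y₂ Y
      isCo : IsCoproduct σ₁ σ₂
    open IsCoproduct isCo public

  complement : ∀ {Y' Y} (σ : Summand Y' Y) → Summand (Summand.Y₂ σ) Y
  complement (summand Y₂ σ₁ σ₂ isCo) = summand _ σ₂ σ₁ record
    { [_,_]  = λ f g → [ g , f ]
    ; inj₁-β = λ f g → inj₂-β g f
    ; inj₂-β = λ f g → inj₁-β g f
    ; unique = λ f g k p q → unique g f k q p }
    where open IsCoproduct isCo

  inlS : ∀ {A B C} {i₁ : Hom A C} {i₂ : Hom B C} → IsCoproduct i₁ i₂ → Summand A C
  inlS {i₁ = i₁} {i₂} c = summand _ i₁ i₂ c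

  inrS : ∀ {A B C} {i₁ : Hom A C} {i₂ : Hom B C} → IsCoproduct i₁ i₂ → Summand B C
  inrS c = complement (inlS c)

  -- Composite summand σθ = (σ₁ ∘ θ₁ , [σ₂ , σ₁ ∘ θ₂]) : Y'' ◁ Y, where the
  -- copairing is taken w.r.t. the chosen coproduct Y₂ + Y'₂ of the
  -- co-Cartesian structure.
  module _ (co : CoCartesian) where
    open CoCartesian co

    composite : ∀ {Y'' Y' Y} (σ : Summand Y' Y) (θ : Summand Y'' Y') → Summand Y'' Y
    composite {Y''} {Y'} {Y} σ θ =
      summand (S.Y₂ ⊕ T.Y₂) (S.σ₁ ∘ T.σ₁) s₂ record
        { [_,_]  = cp
        ; inj₁-β = β₁
        ; inj₂-β = β₂
        ; unique = uq }
      where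
        module S = Summand σ
        module T = Summand θ
        module P = IsCoproduct (isCoproduct {S.Y₂} {T.Y₂})
        s₂ : Hom (S.Y₂ ⊕ T.Y₂) Y
        s₂ = P.[ S.σ₂ , S.σ₁ ∘ T.σ₂ ]
        cp : ∀ {D} → Hom Y'' D → Hom (S.Y₂ ⊕ T.Y₂) D → Hom Y D
        cp f g = S.[ T.[ f , g ∘ ι₂ ] , g ∘ ι₁ ]
        β₁ : ∀ {D} (f : Hom Y'' D) g → cp f g ∘ (S.σ₁ ∘ T.σ₁) ≡ f
        β₁ f g = trans (sym (assoc _ _ _))
                   (trans (cong (_∘ T.σ₁) (S.inj₁-β _ _)) (T.inj₁-β _ _))
        β₂ : ∀ {D} (f : Hom Y'' D) g → cp f g ∘ s₂ ≡ g
        β₂ f g = trans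
          (P.unique _ _ (cp f g ∘ s₂)
            (trans (assoc _ _ _) (trans (cong (cp f g ∘_) (P.inj₁-β _ _)) (S.inj₂-β _ _)))
            (trans (assoc _ _ _) (trans (cong (cp f g ∘_) (P.inj₂-β _ _))
              (trans (sym (assoc _ _ _))
                (trans (cong (_∘ T.σ₂) (S.inj₁-β _ _)) (T.inj₂-β _ _))))))
          (sym (P.unique _ _ g refl refl))
        uq : ∀ {D} (f : Hom Y'' D) g (k : Hom Y D) →
             k ∘ (S.σ₁ ∘ T.σ₁) ≡ f → k ∘ s₂ ≡ g → k ≡ cp f g
        uq f g k p q = S.unique _ _ k
          (T.unique _ _ (k ∘ S.σ₁) (trans (assoc _ _ _) p)
             (trans (assoc _ _ _)
               (trans (cong (k ∘_) (sym (P.inj₂-β S.σ₂ (S.σ₁ ∘ T.σ₂))))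
                 (trans (sym (assoc _ _ _)) (cong (_∘ ι₂) q)))))
          (trans (cong (k ∘_) (sym (P.inj₁-β S.σ₂ (S.σ₁ ∘ T.σ₂))))
            (trans (sym (assoc _ _ _)) (cong (_∘ ι₁) q)))

  record AbstractlyGuarded (ℓ : Level) : Set (o ⊔ h ⊔ suc ℓ) where
    field
      Guarded : ∀ {X Y Y'} → Hom X Y → Summand Y' Y → Set ℓ
      trv : ∀ {X Y Z W} {i₁ : Hom Y W} {i₂ : Hom Z W} (c : IsCoproduct i₁ i₂)
              (f : Hom X Y) → Guarded (i₁ ∘ f) (inrS c)
      par : ∀ {X Y W Z Z'} {i₁ : Hom X W} {i₂ : Hom Y W} (c : IsCoproduct i₁ i₂)
              (σ : Summand Z' Z) (f : Hom X Z) (g : Hom Y Z) →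
              Guarded f σ → Guarded g σ →
              Guarded (IsCoproduct.[_,_] c f g) σ
      cmp : ∀ {X Y Z W V V'} {i₁ : Hom Y W} {i₂ : Hom Z W} (c : IsCoproduct i₁ i₂)
              (σ : Summand V' V) (f : Hom X W) (g : Hom Y V) (k : Hom Z V) →
              Guarded f (inrS c) → Guarded g σ →
              Guarded (IsCoproduct.[_,_] c g k ∘ f) σ

module Submission where

open import Relation.Binary.PropositionalEquality using (_≡_; sym; trans; cong; subst)
open import Defs

-- Idea: f is recovered as [σ₂ , σ₁] ∘ f along the complementary cospan of σ,
-- so by (cmp) it is guarded by any τ that guards the complement injection σ₂.
-- For τ = σθ this holds by (trv), since σ₂ is the first component of the
-- complement injection [σ₂ , σ₁ ∘ θ₂] of σθ.

module _ {o h} {𝒞 : Category o h} where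
  open Category 𝒞

  copair-injections : ∀ {Y' Y} (σ : Summand 𝒞 Y' Y) →
                      Summand.[_,_] σ (Summand.σ₁ σ) (Summand.σ₂ σ) ≡ id
  copair-injections σ = sym (unique σ₁ σ₂ id (idˡ σ₁) (idˡ σ₂))
    where open Summand σ

  module _ {ℓ} (G : AbstractlyGuarded 𝒞 ℓ) where
    open AbstractlyGuarded G

    complement-injection-guarded : ∀ {X Y' Y} (σ : Summand 𝒞 Y' Y)
                                   (k : Hom X (Summand.Y₂ σ)) →
                                   Guarded (Summand.σ₂ σ ∘ k) σ
    complement-injection-guarded σ = trv (Summand.isCo (complement 𝒞 σ))

    guarded-weaken : ∀ {X Y Y' Y''} {f : Hom X Y}
                     (σ : Summand 𝒞 Y' Y) (τ : Summand 𝒞 Y'' Y) →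
                     Guarded f σ → Guarded (Summand.σ₂ σ) τ → Guarded f τ
    guarded-weaken {f = f} σ τ f-σ σ₂-τ =
      subst (λ u → Guarded u τ) copair∘f≡f
        (cmp (Summand.isCo (complement 𝒞 σ)) τ f σ₂ σ₁ f-σ σ₂-τ)
      where
        open Summand σ
        copair∘f≡f : [ σ₁ , σ₂ ] ∘ f ≡ f
        copair∘f≡f = trans (cong (_∘ f) (copair-injections σ)) (idˡ f)

    composite-complement-guarded : (co : CoCartesian 𝒞) →
                                   ∀ {Y'' Y' Y} (σ : Summand 𝒞 Y' Y) (θ : Summand 𝒞 Y'' Y') →
                                   Guarded (Summand.σ₂ σ) (composite 𝒞 co σ θ)
    composite-complement-guarded co σ θ =
      subst (λ u → Guarded u σθ) (P.inj₁-β _ _)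
        (complement-injection-guarded σθ ι₁)
      where
        open CoCartesian co
        σθ = composite 𝒞 co σ θ
        module P = IsCoproduct (isCoproduct {Summand.Y₂ σ} {Summand.Y₂ θ})

proposition3p2 : ∀ {o h ℓ} (𝒞 : Category o h) (co : CoCartesian 𝒞)
    (G : AbstractlyGuarded 𝒞 ℓ) →
    let open Category 𝒞 in
    ∀ {X Y Y' Y''} (f : Hom X Y) (σ : Summand 𝒞 Y' Y) (θ : Summand 𝒞 Y'' Y') →
    AbstractlyGuarded.Guarded G f σ →
    AbstractlyGuarded.Guarded G f (composite 𝒞 co σ θ)
proposition3p2 𝒞 co G f σ θ f-σ =
  guarded-weaken G σ (composite 𝒞 co σ θ) f-σ (composite-complement-guarded G co σ θ)
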